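{- Let $F\colon(\mathcal{C},T,C,\succeq)\to(\mathcal{C}',T',C',\succeq')$ be a target–context functor. Then the assignments $s\mapsto F(s)$ on simulators and $(r,q)\mapsto(F(r),F(q))$ on simulator morphisms define a functor $\mathrm{Sim}(F)\colon\mathrm{Sim}(\mathcal{C})\to\mathrm{Sim}(\mathcal{C}')$ between the simulator categories (coherence isomorphisms of $F$ suppressed).
   Context: A gs-monoidal category is a symmetric monoidal category (tensor $\otimes$, unit $I$) whose objects carry commutative comonoids $\mathrm{copy}_A\colon A\to A\otimes A$, $\mathrm{del}_A\colon A\to I$ compatible with $\otimes$, with $\mathrm{del}_I=\mathrm{id}_I$. For $f\colon A\to X$: $\mathrm{dom}(f)=(\mathrm{id}_A\otimes(\mathrm{del}_X\circ f))\circ\mathrm{copy}_A$; normalized: $f\circ\mathrm{dom}(f)=f$; functional: $\mathrm{copy}_X\circ f=(f\otimes f)\circ\mathrm{copy}_A$. A target–context category $(\mathcal{C},T,C,\succeq)$ is a gs-monoidal category with all morphisms normalized, objects $T,C$ and a preorder $\succeq$ on each $\mathcal{C}(A,T\otimes C)$ with $f\circ\mathrm{dom}(g)=g\Rightarrow f\succeq g$ and $f\succeq g\Rightarrow f\circ h\succeq g\circ h$. A simulator with programs $P$: $s\colon P\otimes C\to T\otimes C$ such that there are a functional $s_T\colon P\to T$ and $s_C\colon P\otimes C\to C$ with $s=(s_T\otimes s_C)\circ(\mathrm{copy}_P\otimes\mathrm{id}_C)$, $(\mathrm{id}_T\otimes\mathrm{del}_C)\circ s=s_T\otimes\mathrm{del}_C$,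 $(\mathrm{del}_T\otimes\mathrm{id}_C)\circ s=s_C$. For simulators $s$ (programs $P$), $s'$ (programs $P'$), a simulator morphism $(r,q)\colon s\to s'$ is a functional $r\colon P'\to P$ and $q\colon P'\otimes T\otimes C\to T\otimes C$ such that (i) $q$ is a simulator with programs $P'\otimes T$; (ii) $\mathrm{del}_{P'}\otimes\mathrm{id}_{T\otimes C}\succeq q$; (iii) $s'=q\circ(\mathrm{id}_{P'}\otimes(s\circ(r\otimes\mathrm{id}_C)))\circ(\mathrm{copy}_{P'}\otimes\mathrm{id}_C)$. The simulator category $\mathrm{Sim}(\mathcal{C})$ has simulators as objects and simulator morphisms as morphisms; the identity on $s$ is $(\mathrm{id}_P,\mathrm{del}_P\otimes\mathrm{id}_{T\otimes C})$, and the composite of $(r_1,q_1)\colon s\to s_1$ and $(r_2,q_2)\colon s_1\to s_2$ (programs $P,P_1,P_2$) is $(r_1\circ r_2,\,q')$ with $q'=q_2\circ(\mathrm{id}_{P_2}\otimes(q_1\circ(r_2\otimes\mathrm{id}_{T\otimes C})))\circ(\mathrm{copy}_{P_2}\otimes\mathrm{id}_{T\otimes C})$. A target–context functor $(\mathcal{C},T,C,\succeq)\to(\mathcal{C}',T',C',\succeq')$ is a strong gs-monoidal functor $F\colon\mathcal{C}\to\mathcal{C}'$ (a strong symmetric monoidal functor which, up to its coherence isomorphisms, sends $\mathrm{copy}_A$ to $\mathrm{copy}_{FA}$ and $\mathrm{del}_A$ to $\mathrm{del}_{FA}$) with $F(T)=T'$, $F(C)=C'$, and $f\succeq g\Rightarrow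 F(f)\succeq' F(g)$ for all $f,g\colon A\to T\otimes C$. -}

module Defs where

open import Level using (Level; _⊔_) renaming (suc to lsuc)
open import Relation.Binary.Core using (Rel)
open import Relation.Binary.Structures using (IsEquivalence)
open import Relation.Binary.PropositionalEquality.Core using (_≡_; refl; sym)
open import Data.Product.Base using (_×_)

record Category (o ℓ e : Level) : Set (lsuc (o ⊔ ℓ ⊔ e)) where
  infixr 9 _∘_
  infix  4 _≈_
  infix  5 _⇒_
  field
    Obj : Set o
    _⇒_ : Obj → Obj → Set ℓ
    _≈_ : ∀ {A B} → Rel (A ⇒ B) e
    id  : ∀ {A} → A ⇒ A
    _∘_ : ∀ {A B D} → B ⇒ D → A ⇒ B → A ⇒ D
    ≈-equiv   : ∀ {A B} → IsEquivalence (_≈_ {A} {B})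
    ∘-resp-≈  : ∀ {A B D} {f h : B ⇒ D} {g i : A ⇒ B} →
                f ≈ h → g ≈ i → f ∘ g ≈ h ∘ i
    identityˡ : ∀ {A B} {f : A ⇒ B} → id ∘ f ≈ f
    identityʳ : ∀ {A B} {f : A ⇒ B} → f ∘ id ≈ f
    assoc     : ∀ {A B D E} {f : A ⇒ B} {g : B ⇒ D} {h : D ⇒ E} →
                (h ∘ g) ∘ f ≈ h ∘ (g ∘ f)

  ≡⇒ : ∀ {A B} → A ≡ B → A ⇒ B
  ≡⇒ refl = id

record Monoidal {o ℓ e} (𝒞 : Category o ℓ e) : Set (o ⊔ ℓ ⊔ e) where
  open Category 𝒞
  infixr 10 _⊗₀_ _⊗₁_
  field
    _⊗₀_ : Obj → Obj → Obj
    _⊗₁_ : ∀ {A B X Y} → A ⇒ B → X ⇒ Y → A ⊗₀ X ⇒ B ⊗₀ Y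
    unit : Obj
    ⊗-id     : ∀ {A B} → id {A} ⊗₁ id {B} ≈ id
    ⊗-∘      : ∀ {A B D X Y Z} {f : B ⇒ D} {g : A ⇒ B} {h : Y ⇒ Z} {i : X ⇒ Y} →
               (f ∘ g) ⊗₁ (h ∘ i) ≈ (f ⊗₁ h) ∘ (g ⊗₁ i)
    ⊗-resp-≈ : ∀ {A B X Y} {f g : A ⇒ B} {h i : X ⇒ Y} →
               f ≈ g → h ≈ i → f ⊗₁ h ≈ g ⊗₁ i
    α⇒ : ∀ {A B D} → (A ⊗₀ B) ⊗₀ D ⇒ A ⊗₀ (B ⊗₀ D)
    α⇐ : ∀ {A B D} → A ⊗₀ (B ⊗₀ D) ⇒ (A ⊗₀ B) ⊗₀ D
    α-isoˡ : ∀ {A B D} → α⇐ ∘ α⇒ {A} {B} {D} ≈ id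
    α-isoʳ : ∀ {A B D} → α⇒ ∘ α⇐ {A} {B} {D} ≈ id
    α-nat  : ∀ {A B D X Y Z} {f : A ⇒ X} {g : B ⇒ Y} {h : D ⇒ Z} →
             α⇒ ∘ ((f ⊗₁ g) ⊗₁ h) ≈ (f ⊗₁ (g ⊗₁ h)) ∘ α⇒
    λ⇒ : ∀ {A} → unit ⊗₀ A ⇒ A
    λ⇐ : ∀ {A} → A ⇒ unit ⊗₀ A
    λ-isoˡ : ∀ {A} → λ⇐ ∘ λ⇒ {A} ≈ id
    λ-isoʳ : ∀ {A} → λ⇒ ∘ λ⇐ {A} ≈ id
    λ-nat  : ∀ {A B} {f : A ⇒ B} → λ⇒ ∘ (id ⊗₁ f) ≈ f ∘ λ⇒
    ρ⇒ : ∀ {A} → A ⊗₀ unit ⇒ A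
    ρ⇐ : ∀ {A} → A ⇒ A ⊗₀ unit
    ρ-isoˡ : ∀ {A} → ρ⇐ ∘ ρ⇒ {A} ≈ id
    ρ-isoʳ : ∀ {A} → ρ⇒ ∘ ρ⇐ {A} ≈ id
    ρ-nat  : ∀ {A B} {f : A ⇒ B} → ρ⇒ ∘ (f ⊗₁ id) ≈ f ∘ ρ⇒
    triangle : ∀ {A B} → (id ⊗₁ λ⇒) ∘ α⇒ ≈ ρ⇒ {A} ⊗₁ id {B}
    pentagon : ∀ {A B D E} →
               (id {A} ⊗₁ α⇒ {B} {D} {E}) ∘ α⇒ ∘ (α⇒ ⊗₁ id) ≈ α⇒ ∘ α⇒

record Symmetric {o ℓ e} {𝒞 : Category o ℓ e} (M : Monoidal 𝒞) : Set (o ⊔ ℓ ⊔ e) where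
  open Category 𝒞
  open Monoidal M
  field
    σ : ∀ {A B} → A ⊗₀ B ⇒ B ⊗₀ A
    σ-invol : ∀ {A B} → σ ∘ σ {A} {B} ≈ id
    σ-nat   : ∀ {A B X Y} {f : A ⇒ X} {g : B ⇒ Y} → σ ∘ (f ⊗₁ g) ≈ (g ⊗₁ f) ∘ σ
    hexagon : ∀ {A B D} →
              α⇒ ∘ σ {A} {B ⊗₀ D} ∘ α⇒ ≈ (id ⊗₁ σ) ∘ α⇒ ∘ (σ ⊗₁ id)

record GSMonoidalCategory (o ℓ e : Level) : Set (lsuc (o ⊔ ℓ ⊔ e)) where
  field
    cat : Category o ℓ e
    mon : Monoidal cat
    symm : Symmetric mon
  open Category cat public
  open Monoidal mon public
  open Symmetric symm public

  interchange : ∀ {A B} → (A ⊗₀ A) ⊗₀ (B ⊗₀ B) ⇒ (A ⊗₀ B) ⊗₀ (A ⊗₀ B)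
  interchange = α⇐ ∘ (id ⊗₁ (α⇒ ∘ (σ ⊗₁ id) ∘ α⇐)) ∘ α⇒

  field
    copy : ∀ {A} → A ⇒ A ⊗₀ A
    del  : ∀ {A} → A ⇒ unit
    copy-assoc : ∀ {A} → α⇒ ∘ (copy ⊗₁ id) ∘ copy {A} ≈ (id ⊗₁ copy) ∘ copy
    counitˡ    : ∀ {A} → λ⇒ ∘ (del ⊗₁ id) ∘ copy {A} ≈ id
    counitʳ    : ∀ {A} → ρ⇒ ∘ (id ⊗₁ del) ∘ copy {A} ≈ id
    copy-comm  : ∀ {A} → σ ∘ copy {A} ≈ copy
    copy-⊗    : ∀ {A B} → copy {A ⊗₀ B} ≈ interchange ∘ (copy ⊗₁ copy)
    del-⊗     : ∀ {A B} → del {A ⊗₀ B} ≈ λ⇒ ∘ (del ⊗₁ del)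
    del-unit  : del {unit} ≈ id

  dom : ∀ {A X} → A ⇒ X → A ⇒ A ⊗₀ unit
  dom f = (id ⊗₁ (del ∘ f)) ∘ copy

  -- f ∘ dom(f) = f   (the unitor A ⊗ I ≅ A made explicit)
  Normalized : ∀ {A X} → A ⇒ X → Set e
  Normalized f = f ∘ ρ⇒ ∘ dom f ≈ f

  Functional : ∀ {A X} → A ⇒ X → Set e
  Functional f = copy ∘ f ≈ (f ⊗₁ f) ∘ copy

record TCCategory (o ℓ e r : Level) : Set (lsuc (o ⊔ ℓ ⊔ e ⊔ r)) where
  field
    gs : GSMonoidalCategory o ℓ e
  open GSMonoidalCategory gs public
  field
    T C : Obj
    normalized : ∀ {A X} (f : A ⇒ X) → Normalized f
    _≽_ : ∀ {A} → Rel (A ⇒ T ⊗₀ C) r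
    ≽-refl  : ∀ {A} {f : A ⇒ T ⊗₀ C} → f ≽ f
    ≽-trans : ∀ {A} {f g h : A ⇒ T ⊗₀ C} → f ≽ g → g ≽ h → f ≽ h
    ≽-dom   : ∀ {A} {f g : A ⇒ T ⊗₀ C} → f ∘ ρ⇒ ∘ dom g ≈ g → f ≽ g
    ≽-∘     : ∀ {A B} {f g : A ⇒ T ⊗₀ C} (h : B ⇒ A) → f ≽ g → (f ∘ h) ≽ (g ∘ h)

module _ {o ℓ e r} (𝒯 : TCCategory o ℓ e r) where
  open TCCategory 𝒯

  record IsSimulator (P : Obj) (s : P ⊗₀ C ⇒ T ⊗₀ C) : Set (ℓ ⊔ e) where
    field
      sT : P ⇒ T
      sC : P ⊗₀ C ⇒ C
      sT-functional : Functional sT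
      decompose : s ≈ (sT ⊗₁ sC) ∘ α⇒ ∘ (copy ⊗₁ id)
      marginalT : (id ⊗₁ del) ∘ s ≈ sT ⊗₁ del
      marginalC : λ⇒ ∘ (del ⊗₁ id) ∘ s ≈ sC

  record Simulator : Set (o ⊔ ℓ ⊔ e) where
    constructor simulator
    field
      P     : Obj
      run   : P ⊗₀ C ⇒ T ⊗₀ C
      isSim : IsSimulator P run

  open Simulator

  record IsSimMor (s s' : Simulator) (r' : P s' ⇒ P s)
                  (q : P s' ⊗₀ (T ⊗₀ C) ⇒ T ⊗₀ C) : Set (ℓ ⊔ e ⊔ r) where
    field
      r-functional : Functional r'
      q-simulator  : IsSimulator (P s' ⊗₀ T) (q ∘ α⇒)
      q-bounded    : (λ⇒ ∘ (del ⊗₁ id)) ≽ q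
      factor       : run s' ≈ q ∘ (id ⊗₁ (run s ∘ (r' ⊗₁ id))) ∘ α⇒ ∘ (copy ⊗₁ id)

  record SimMor (s s' : Simulator) : Set (ℓ ⊔ e ⊔ r) where
    field
      rm    : P s' ⇒ P s
      qm    : P s' ⊗₀ (T ⊗₀ C) ⇒ T ⊗₀ C
      isMor : IsSimMor s s' rm qm

  -- second component of the identity (id_P , del_P ⊗ id_{T⊗C})
  idQ : (P : Obj) → P ⊗₀ (T ⊗₀ C) ⇒ T ⊗₀ C
  idQ P = λ⇒ ∘ (del ⊗₁ id)

  -- second component of the composite of (r₁,q₁) : s → s₁ and (r₂,q₂) : s₁ → s₂
  compQ : ∀ {P₁ P₂} → P₂ ⇒ P₁ → P₁ ⊗₀ (T ⊗₀ C) ⇒ T ⊗₀ C →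
          P₂ ⊗₀ (T ⊗₀ C) ⇒ T ⊗₀ C → P₂ ⊗₀ (T ⊗₀ C) ⇒ T ⊗₀ C
  compQ r₂ q₁ q₂ = q₂ ∘ (id ⊗₁ (q₁ ∘ (r₂ ⊗₁ id))) ∘ α⇒ ∘ (copy ⊗₁ id)

record Functor {o ℓ e o' ℓ' e'} (𝒞 : Category o ℓ e) (𝒟 : Category o' ℓ' e')
       : Set (o ⊔ ℓ ⊔ e ⊔ o' ⊔ ℓ' ⊔ e') where
  private
    module C = Category 𝒞
    module D = Category 𝒟
  field
    F₀ : C.Obj → D.Obj
    F₁ : ∀ {A B} → A C.⇒ B → F₀ A D.⇒ F₀ B
    F-id     : ∀ {A} → F₁ (C.id {A}) D.≈ D.id
    F-∘      : ∀ {A B X} {f : B C.⇒ X} {g : A C.⇒ B} → F₁ (f C.∘ g) D.≈ F₁ f D.∘ F₁ g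
    F-resp-≈ : ∀ {A B} {f g : A C.⇒ B} → f C.≈ g → F₁ f D.≈ F₁ g

record StrongGSFunctor {o ℓ e o' ℓ' e'} (𝒞 : GSMonoidalCategory o ℓ e)
       (𝒟 : GSMonoidalCategory o' ℓ' e') : Set (o ⊔ ℓ ⊔ e ⊔ o' ⊔ ℓ' ⊔ e') where
  private
    module C = GSMonoidalCategory 𝒞
    module D = GSMonoidalCategory 𝒟
  field
    functor : Functor C.cat D.cat
  open Functor functor public
  field
    μ⇒ : ∀ {A B} → F₀ A D.⊗₀ F₀ B D.⇒ F₀ (A C.⊗₀ B)
    μ⇐ : ∀ {A B} → F₀ (A C.⊗₀ B) D.⇒ F₀ A D.⊗₀ F₀ B
    μ-isoˡ : ∀ {A B} → μ⇐ D.∘ μ⇒ {A} {B} D.≈ D.id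
    μ-isoʳ : ∀ {A B} → μ⇒ D.∘ μ⇐ {A} {B} D.≈ D.id
    ε⇒ : D.unit D.⇒ F₀ C.unit
    ε⇐ : F₀ C.unit D.⇒ D.unit
    ε-isoˡ : ε⇐ D.∘ ε⇒ D.≈ D.id
    ε-isoʳ : ε⇒ D.∘ ε⇐ D.≈ D.id
    μ-nat : ∀ {A B X Y} {f : A C.⇒ X} {g : B C.⇒ Y} →
            μ⇒ D.∘ (F₁ f D.⊗₁ F₁ g) D.≈ F₁ (f C.⊗₁ g) D.∘ μ⇒
    F-α : ∀ {A B X} →
          F₁ (C.α⇒ {A} {B} {X}) D.∘ μ⇒ D.∘ (μ⇒ D.⊗₁ D.id)
            D.≈ μ⇒ D.∘ (D.id D.⊗₁ μ⇒) D.∘ D.α⇒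
    F-λ : ∀ {A} → F₁ (C.λ⇒ {A}) D.∘ μ⇒ D.∘ (ε⇒ D.⊗₁ D.id) D.≈ D.λ⇒
    F-ρ : ∀ {A} → F₁ (C.ρ⇒ {A}) D.∘ μ⇒ D.∘ (D.id D.⊗₁ ε⇒) D.≈ D.ρ⇒
    F-σ : ∀ {A B} → F₁ (C.σ {A} {B}) D.∘ μ⇒ D.≈ μ⇒ D.∘ D.σ
    F-copy : ∀ {A} → F₁ (C.copy {A}) D.≈ μ⇒ D.∘ D.copy
    F-del  : ∀ {A} → F₁ (C.del {A}) D.≈ ε⇒ D.∘ D.del

record TCFunctor {o ℓ e r o' ℓ' e' r'} (𝒯 : TCCategory o ℓ e r) (𝒯' : TCCategory o' ℓ' e' r')
       : Set (o ⊔ ℓ ⊔ e ⊔ r ⊔ o' ⊔ ℓ' ⊔ e' ⊔ r') where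
  private
    module C = TCCategory 𝒯
    module D = TCCategory 𝒯'
  field
    gsFunctor : StrongGSFunctor C.gs D.gs
  open StrongGSFunctor gsFunctor public
  field
    F-T : F₀ C.T ≡ D.T
    F-C : F₀ C.C ≡ D.C
  -- F applied to a morphism into T ⊗ C, viewed (via the coherence
  -- isomorphisms of F and F T = T', F C = C') as a morphism into T' ⊗ C'
  outTC : F₀ (C.T C.⊗₀ C.C) D.⇒ D.T D.⊗₀ D.C
  outTC = (D.≡⇒ F-T D.⊗₁ D.≡⇒ F-C) D.∘ μ⇐

  field
    F-≽ : ∀ {A} {f g : A C.⇒ C.T C.⊗₀ C.C} → f C.≽ g →
          (outTC D.∘ F₁ f) D.≽ (outTC D.∘ F₁ g)

  inTC : D.T D.⊗₀ D.C D.⇒ F₀ (C.T C.⊗₀ C.C)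
  inTC = μ⇒ D.∘ (D.≡⇒ (sym F-T) D.⊗₁ D.≡⇒ (sym F-C))

  Fsim : ∀ {P} → P C.⊗₀ C.C C.⇒ C.T C.⊗₀ C.C → F₀ P D.⊗₀ D.C D.⇒ D.T D.⊗₀ D.C
  Fsim s = outTC D.∘ F₁ s D.∘ μ⇒ D.∘ (D.id D.⊗₁ D.≡⇒ (sym F-C))

  Fq : ∀ {P} → P C.⊗₀ (C.T C.⊗₀ C.C) C.⇒ C.T C.⊗₀ C.C →
       F₀ P D.⊗₀ (D.T D.⊗₀ D.C) D.⇒ D.T D.⊗₀ D.C
  Fq q = outTC D.∘ F₁ q D.∘ μ⇒ D.∘ (D.id D.⊗₁ inTC)

record SimFunctor {o ℓ e r o' ℓ' e' r'} {𝒯 : TCCategory o ℓ e r}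
       {𝒯' : TCCategory o' ℓ' e' r'} (𝔽 : TCFunctor 𝒯 𝒯')
       : Set (o ⊔ ℓ ⊔ e ⊔ r ⊔ o' ⊔ ℓ' ⊔ e' ⊔ r') where
  private
    module C = TCCategory 𝒯
    module D = TCCategory 𝒯'
  open TCFunctor 𝔽
  open Simulator
  open SimMor
  field
    obj-isSim : (s : Simulator 𝒯) → IsSimulator 𝒯' (F₀ (P s)) (Fsim (run s))

  Sim₀ : Simulator 𝒯 → Simulator 𝒯'
  Sim₀ s = simulator (F₀ (P s)) (Fsim (run s)) (obj-isSim s)

  field
    mor-isMor : ∀ {s s'} (m : SimMor 𝒯 s s') →
                IsSimMor 𝒯' (Sim₀ s) (Sim₀ s') (F₁ (rm m)) (Fq (qm m))
    resp-≈ : ∀ {s s'} (m m' : SimMor 𝒯 s s') →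
             rm m C.≈ rm m' → qm m C.≈ qm m' →
             (F₁ (rm m) D.≈ F₁ (rm m')) × (Fq (qm m) D.≈ Fq (qm m'))
    pres-id : (s : Simulator 𝒯) →
              (F₁ (C.id {P s}) D.≈ D.id) × (Fq (idQ 𝒯 (P s)) D.≈ idQ 𝒯' (F₀ (P s)))
    pres-∘ : ∀ {s s₁ s₂} (m₁ : SimMor 𝒯 s s₁) (m₂ : SimMor 𝒯 s₁ s₂) →
             (F₁ (rm m₁ C.∘ rm m₂) D.≈ F₁ (rm m₁) D.∘ F₁ (rm m₂))
             × (Fq (compQ 𝒯 (rm m₂) (qm m₁) (qm m₂))
                  D.≈ compQ 𝒯' (F₁ (rm m₂)) (Fq (qm m₁)) (Fq (qm m₂)))

{-# OPTIONS --safe #-}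
-- A strong gs-monoidal functor F preserves every equation built from
-- composites, tensors, structure maps and comonoid maps, but only up to its
-- coherence isomorphisms μ, ε and the identifications F T = T', F C = C'.
-- We make this precise by fixing, for each tensor expression in the source,
-- an isomorphism ("representation") between the corresponding tensor of
-- target objects and F applied to it, and by saying that g represents f when
-- g is F f read through these isomorphisms. Representatives compose, tensor,
-- and exist for all structure maps, and equal morphisms have equal
-- representatives; so each defining equation of a simulator, of a simulator
-- morphism, and of the identity and composite of Sim(C) is carried over by
-- building representing squares for both of its sides.
module Submission where

open import Level using (_⊔_)
open import Relation.Binary.Bundles using (Setoid)
open import Relation.Binary.Structures using (IsEquivalence)
open import Relation.Binary.PropositionalEquality.Core using (_≡_; refl) renaming (sym to ≡-sym)
open import Data.Product.Base using (_,_)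
open import Defs

module HomReasoning {o ℓ e} (𝒞 : Category o ℓ e) where
  open Category 𝒞

  module ≈ {A B} = IsEquivalence (≈-equiv {A} {B})

  hom-setoid : Obj → Obj → Setoid ℓ e
  hom-setoid A B = record { isEquivalence = ≈-equiv {A} {B} }

  module _ {A B : Obj} where
    open import Relation.Binary.Reasoning.Setoid (hom-setoid A B) public

  infixr 4 _⟩∘⟨_
  infix 4 refl⟩∘⟨_ _⟩∘⟨refl

  _⟩∘⟨_ : ∀ {A B D} {f h : B ⇒ D} {g i : A ⇒ B} → f ≈ h → g ≈ i → f ∘ g ≈ h ∘ i
  _⟩∘⟨_ = ∘-resp-≈

  refl⟩∘⟨_ : ∀ {A B D} {f : B ⇒ D} {g i : A ⇒ B} → g ≈ i → f ∘ g ≈ f ∘ i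
  refl⟩∘⟨ p = ≈.refl ⟩∘⟨ p

  _⟩∘⟨refl : ∀ {A B D} {f h : B ⇒ D} {g : A ⇒ B} → f ≈ h → f ∘ g ≈ h ∘ g
  p ⟩∘⟨refl = p ⟩∘⟨ ≈.refl

  sym-assoc : ∀ {A B D E} {f : A ⇒ B} {g : B ⇒ D} {h : D ⇒ E} → h ∘ (g ∘ f) ≈ (h ∘ g) ∘ f
  sym-assoc = ≈.sym assoc

module _ {o ℓ e} (𝒞 : GSMonoidalCategory o ℓ e) where
  open GSMonoidalCategory 𝒞

  cascade : ∀ {P P' X Y Z} → P ⊗₀ Y ⇒ Z → P' ⊗₀ X ⇒ Y → P ⇒ P' → P ⊗₀ X ⇒ Z
  cascade q x r = q ∘ (id ⊗₁ (x ∘ (r ⊗₁ id))) ∘ α⇒ ∘ (copy ⊗₁ id)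

module _ {o ℓ e r} (𝒯 : TCCategory o ℓ e r) where
  open TCCategory 𝒯
  open HomReasoning cat

  ≈⇒≽ : ∀ {A} {f g : A ⇒ T ⊗₀ C} → f ≈ g → f ≽ g
  ≈⇒≽ {g = g} f≈g = ≽-dom (≈.trans (f≈g ⟩∘⟨refl) (normalized g))

module Transport {o ℓ e o' ℓ' e'} {𝒞 : GSMonoidalCategory o ℓ e}
                 {𝒟 : GSMonoidalCategory o' ℓ' e'} (F : StrongGSFunctor 𝒞 𝒟) where
  private
    module C = GSMonoidalCategory 𝒞
    module C≈ {A B} = IsEquivalence (C.≈-equiv {A} {B})
  open GSMonoidalCategory 𝒟
  open HomReasoning cat
  open StrongGSFunctor F

  -- A representation of F A: a tensor expression in 𝒟 whose leaves are
  -- objects propositionally equal to images F A.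
  data Rep : C.Obj → Set (o ⊔ o') where
    base  : ∀ {A} {A' : Obj} → F₀ A ≡ A' → Rep A
    unitᴿ : Rep C.unit
    _⊗ᴿ_  : ∀ {A B} → Rep A → Rep B → Rep (A C.⊗₀ B)

  ⟦_⟧ : ∀ {A} → Rep A → Obj
  ⟦ base {A' = A'} _ ⟧ = A'
  ⟦ unitᴿ ⟧ = unit
  ⟦ R ⊗ᴿ S ⟧ = ⟦ R ⟧ ⊗₀ ⟦ S ⟧

  to : ∀ {A} (R : Rep A) → ⟦ R ⟧ ⇒ F₀ A
  to (base p) = ≡⇒ (≡-sym p)
  to unitᴿ = ε⇒
  to (R ⊗ᴿ S) = μ⇒ ∘ (to R ⊗₁ to S)

  from : ∀ {A} (R : Rep A) → F₀ A ⇒ ⟦ R ⟧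
  from (base p) = ≡⇒ p
  from unitᴿ = ε⇐
  from (R ⊗ᴿ S) = (from R ⊗₁ from S) ∘ μ⇐

  from∘to : ∀ {A} (R : Rep A) → from R ∘ to R ≈ id
  from∘to (base refl) = identityˡ
  from∘to unitᴿ = ε-isoˡ
  from∘to (R ⊗ᴿ S) = begin
    ((from R ⊗₁ from S) ∘ μ⇐) ∘ (μ⇒ ∘ (to R ⊗₁ to S)) ≈⟨ assoc ⟩
    (from R ⊗₁ from S) ∘ (μ⇐ ∘ (μ⇒ ∘ (to R ⊗₁ to S))) ≈⟨ refl⟩∘⟨ sym-assoc ⟩
    (from R ⊗₁ from S) ∘ ((μ⇐ ∘ μ⇒) ∘ (to R ⊗₁ to S)) ≈⟨ refl⟩∘⟨ (μ-isoˡ ⟩∘⟨refl) ⟩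
    (from R ⊗₁ from S) ∘ (id ∘ (to R ⊗₁ to S))       ≈⟨ refl⟩∘⟨ identityˡ ⟩
    (from R ⊗₁ from S) ∘ (to R ⊗₁ to S)              ≈⟨ ⊗-∘ ⟨
    (from R ∘ to R) ⊗₁ (from S ∘ to S)               ≈⟨ ⊗-resp-≈ (from∘to R) (from∘to S) ⟩
    id ⊗₁ id                                         ≈⟨ ⊗-id ⟩
    id                                               ∎

  to∘from : ∀ {A} (R : Rep A) → to R ∘ from R ≈ id
  to∘from (base refl) = identityˡ
  to∘from unitᴿ = ε-isoʳ
  to∘from (R ⊗ᴿ S) = begin
    (μ⇒ ∘ (to R ⊗₁ to S)) ∘ ((from R ⊗₁ from S) ∘ μ⇐) ≈⟨ assoc ⟩
    μ⇒ ∘ ((to R ⊗₁ to S) ∘ ((from R ⊗₁ from S) ∘ μ⇐)) ≈⟨ refl⟩∘⟨ sym-assoc ⟩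
    μ⇒ ∘ (((to R ⊗₁ to S) ∘ (from R ⊗₁ from S)) ∘ μ⇐) ≈⟨ refl⟩∘⟨ ≈.sym (⊗-∘ ⟩∘⟨refl) ⟩
    μ⇒ ∘ (((to R ∘ from R) ⊗₁ (to S ∘ from S)) ∘ μ⇐) ≈⟨ refl⟩∘⟨ (⊗-resp-≈ (to∘from R) (to∘from S) ⟩∘⟨refl) ⟩
    μ⇒ ∘ ((id ⊗₁ id) ∘ μ⇐)                           ≈⟨ refl⟩∘⟨ (⊗-id ⟩∘⟨refl) ⟩
    μ⇒ ∘ (id ∘ μ⇐)                                   ≈⟨ refl⟩∘⟨ identityˡ ⟩
    μ⇒ ∘ μ⇐                                          ≈⟨ μ-isoʳ ⟩
    id                                               ∎

  F₁ᴿ : ∀ {A B} (R : Rep A) (S : Rep B) → A C.⇒ B → ⟦ R ⟧ ⇒ ⟦ S ⟧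
  F₁ᴿ R S f = from S ∘ F₁ f ∘ to R

  record Represents {A B} (R : Rep A) (S : Rep B) (g : ⟦ R ⟧ ⇒ ⟦ S ⟧) (f : A C.⇒ B) : Set e' where
    constructor represents
    field square : to S ∘ g ≈ F₁ f ∘ to R

  represents-F₁ᴿ : ∀ {A B} (R : Rep A) (S : Rep B) (f : A C.⇒ B) → Represents R S (F₁ᴿ R S f) f
  represents-F₁ᴿ R S f = represents (begin
    to S ∘ (from S ∘ (F₁ f ∘ to R)) ≈⟨ sym-assoc ⟩
    (to S ∘ from S) ∘ (F₁ f ∘ to R) ≈⟨ to∘from S ⟩∘⟨refl ⟩
    id ∘ (F₁ f ∘ to R)              ≈⟨ identityˡ ⟩
    F₁ f ∘ to R                     ∎)

  represents-F₁ : ∀ {A B} (f : A C.⇒ B) → Represents (base refl) (base refl) (F₁ f) f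
  represents-F₁ f = represents (≈.trans identityˡ (≈.sym identityʳ))

  transport : ∀ {A B} {R : Rep A} {S : Rep B} {g h f k} →
              Represents R S g f → Represents R S h k → f C.≈ k → g ≈ h
  transport {R = R} {S} {g} {h} {f} {k} (represents g-sq) (represents h-sq) f≈k = begin
    g                    ≈⟨ identityˡ ⟨
    id ∘ g               ≈⟨ ≈.sym (from∘to S) ⟩∘⟨refl ⟩
    (from S ∘ to S) ∘ g  ≈⟨ assoc ⟩
    from S ∘ (to S ∘ g)  ≈⟨ refl⟩∘⟨ g-sq ⟩
    from S ∘ (F₁ f ∘ to R) ≈⟨ refl⟩∘⟨ (F-resp-≈ f≈k ⟩∘⟨refl) ⟩
    from S ∘ (F₁ k ∘ to R) ≈⟨ refl⟩∘⟨ h-sq ⟨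
    from S ∘ (to S ∘ h)  ≈⟨ sym-assoc ⟩
    (from S ∘ to S) ∘ h  ≈⟨ from∘to S ⟩∘⟨refl ⟩
    id ∘ h               ≈⟨ identityˡ ⟩
    h                    ∎

  represents-resp-≈ : ∀ {A B} {R : Rep A} {S : Rep B} {g h f k} →
                      g ≈ h → f C.≈ k → Represents R S g f → Represents R S h k
  represents-resp-≈ g≈h f≈k (represents sq) =
    represents (≈.trans (refl⟩∘⟨ ≈.sym g≈h) (≈.trans sq (F-resp-≈ f≈k ⟩∘⟨refl)))

  represents-id : ∀ {A} {R : Rep A} → Represents R R id C.id
  represents-id = represents (≈.trans identityʳ (≈.trans (≈.sym identityˡ) (≈.sym F-id ⟩∘⟨refl)))

  represents-∘ : ∀ {A B X} {R : Rep A} {S : Rep B} {U : Rep X} {g' f' g f} →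
                 Represents S U g' g → Represents R S f' f → Represents R U (g' ∘ f') (g C.∘ f)
  represents-∘ {R = R} {S} {U} {g'} {f'} {g} {f} (represents g-sq) (represents f-sq) = represents (begin
    to U ∘ (g' ∘ f')     ≈⟨ sym-assoc ⟩
    (to U ∘ g') ∘ f'     ≈⟨ g-sq ⟩∘⟨refl ⟩
    (F₁ g ∘ to S) ∘ f'   ≈⟨ assoc ⟩
    F₁ g ∘ (to S ∘ f')   ≈⟨ refl⟩∘⟨ f-sq ⟩
    F₁ g ∘ (F₁ f ∘ to R) ≈⟨ sym-assoc ⟩
    (F₁ g ∘ F₁ f) ∘ to R ≈⟨ ≈.sym F-∘ ⟩∘⟨refl ⟩
    F₁ (g C.∘ f) ∘ to R  ∎)

  represents-⊗ : ∀ {A B X Y} {R : Rep A} {S : Rep B} {R' : Rep X} {S' : Rep Y} {f' g' f g} →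
                 Represents R S f' f → Represents R' S' g' g →
                 Represents (R ⊗ᴿ R') (S ⊗ᴿ S') (f' ⊗₁ g') (f C.⊗₁ g)
  represents-⊗ {R = R} {S} {R'} {S'} {f'} {g'} {f} {g} (represents f-sq) (represents g-sq) = represents (begin
    (μ⇒ ∘ (to S ⊗₁ to S')) ∘ (f' ⊗₁ g')     ≈⟨ assoc ⟩
    μ⇒ ∘ ((to S ⊗₁ to S') ∘ (f' ⊗₁ g'))     ≈⟨ refl⟩∘⟨ ⊗-∘ ⟨
    μ⇒ ∘ ((to S ∘ f') ⊗₁ (to S' ∘ g'))      ≈⟨ refl⟩∘⟨ ⊗-resp-≈ f-sq g-sq ⟩
    μ⇒ ∘ ((F₁ f ∘ to R) ⊗₁ (F₁ g ∘ to R'))  ≈⟨ refl⟩∘⟨ ⊗-∘ ⟩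
    μ⇒ ∘ ((F₁ f ⊗₁ F₁ g) ∘ (to R ⊗₁ to R')) ≈⟨ sym-assoc ⟩
    (μ⇒ ∘ (F₁ f ⊗₁ F₁ g)) ∘ (to R ⊗₁ to R') ≈⟨ μ-nat ⟩∘⟨refl ⟩
    (F₁ (f C.⊗₁ g) ∘ μ⇒) ∘ (to R ⊗₁ to R')  ≈⟨ assoc ⟩
    F₁ (f C.⊗₁ g) ∘ (μ⇒ ∘ (to R ⊗₁ to R'))  ∎)

  represents-inverse : ∀ {A B} {R : Rep A} {S : Rep B} {f' g' f g} →
                       Represents R S f' f → f' ∘ g' ≈ id → g C.∘ f C.≈ C.id → Represents S R g' g
  represents-inverse {R = R} {S} {f'} {g'} {f} {g} (represents f-sq) f'∘g' g∘f = represents (begin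
    to R ∘ g'                   ≈⟨ identityˡ ⟨
    id ∘ (to R ∘ g')            ≈⟨ ≈.trans (≈.sym F-id) (F-resp-≈ (C≈.sym g∘f)) ⟩∘⟨refl ⟩
    F₁ (g C.∘ f) ∘ (to R ∘ g')  ≈⟨ F-∘ ⟩∘⟨refl ⟩
    (F₁ g ∘ F₁ f) ∘ (to R ∘ g') ≈⟨ assoc ⟩
    F₁ g ∘ (F₁ f ∘ (to R ∘ g')) ≈⟨ refl⟩∘⟨ sym-assoc ⟩
    F₁ g ∘ ((F₁ f ∘ to R) ∘ g') ≈⟨ refl⟩∘⟨ ≈.sym (f-sq ⟩∘⟨refl) ⟩
    F₁ g ∘ ((to S ∘ f') ∘ g')   ≈⟨ refl⟩∘⟨ assoc ⟩
    F₁ g ∘ (to S ∘ (f' ∘ g'))   ≈⟨ refl⟩∘⟨ (refl⟩∘⟨ f'∘g') ⟩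
    F₁ g ∘ (to S ∘ id)          ≈⟨ refl⟩∘⟨ identityʳ ⟩
    F₁ g ∘ to S                 ∎)

  represents-α⇒ : ∀ {A B X} {R : Rep A} {S : Rep B} {U : Rep X} →
                  Represents ((R ⊗ᴿ S) ⊗ᴿ U) (R ⊗ᴿ (S ⊗ᴿ U)) α⇒ C.α⇒
  represents-α⇒ {R = R} {S} {U} = represents (begin
    (μ⇒ ∘ (to R ⊗₁ (μ⇒ ∘ (to S ⊗₁ to U)))) ∘ α⇒
      ≈⟨ (refl⟩∘⟨ ≈.trans (⊗-resp-≈ (≈.sym identityˡ) ≈.refl) ⊗-∘) ⟩∘⟨refl ⟩
    (μ⇒ ∘ ((id ⊗₁ μ⇒) ∘ (to R ⊗₁ (to S ⊗₁ to U)))) ∘ α⇒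
      ≈⟨ ≈.trans assoc (refl⟩∘⟨ assoc) ⟩
    μ⇒ ∘ ((id ⊗₁ μ⇒) ∘ ((to R ⊗₁ (to S ⊗₁ to U)) ∘ α⇒))
      ≈⟨ refl⟩∘⟨ (refl⟩∘⟨ α-nat) ⟨
    μ⇒ ∘ ((id ⊗₁ μ⇒) ∘ (α⇒ ∘ ((to R ⊗₁ to S) ⊗₁ to U)))
      ≈⟨ ≈.trans (refl⟩∘⟨ sym-assoc) sym-assoc ⟩
    (μ⇒ ∘ ((id ⊗₁ μ⇒) ∘ α⇒)) ∘ ((to R ⊗₁ to S) ⊗₁ to U)
      ≈⟨ ≈.sym F-α ⟩∘⟨refl ⟩
    (F₁ C.α⇒ ∘ (μ⇒ ∘ (μ⇒ ⊗₁ id))) ∘ ((to R ⊗₁ to S) ⊗₁ to U)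
      ≈⟨ ≈.trans assoc (refl⟩∘⟨ assoc) ⟩
    F₁ C.α⇒ ∘ (μ⇒ ∘ ((μ⇒ ⊗₁ id) ∘ ((to R ⊗₁ to S) ⊗₁ to U)))
      ≈⟨ refl⟩∘⟨ (refl⟩∘⟨ ≈.trans (≈.sym ⊗-∘) (⊗-resp-≈ ≈.refl identityˡ)) ⟩
    F₁ C.α⇒ ∘ (μ⇒ ∘ ((μ⇒ ∘ (to R ⊗₁ to S)) ⊗₁ to U)) ∎)

  represents-α⇐ : ∀ {A B X} {R : Rep A} {S : Rep B} {U : Rep X} →
                  Represents (R ⊗ᴿ (S ⊗ᴿ U)) ((R ⊗ᴿ S) ⊗ᴿ U) α⇐ C.α⇐
  represents-α⇐ = represents-inverse represents-α⇒ α-isoʳ C.α-isoˡ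

  represents-λ⇒ : ∀ {A} {R : Rep A} → Represents (unitᴿ ⊗ᴿ R) R λ⇒ C.λ⇒
  represents-λ⇒ {R = R} = represents (begin
    to R ∘ λ⇒                                     ≈⟨ λ-nat ⟨
    λ⇒ ∘ (id ⊗₁ to R)                             ≈⟨ ≈.sym F-λ ⟩∘⟨refl ⟩
    (F₁ C.λ⇒ ∘ (μ⇒ ∘ (ε⇒ ⊗₁ id))) ∘ (id ⊗₁ to R)  ≈⟨ ≈.trans assoc (refl⟩∘⟨ assoc) ⟩
    F₁ C.λ⇒ ∘ (μ⇒ ∘ ((ε⇒ ⊗₁ id) ∘ (id ⊗₁ to R)))  ≈⟨ refl⟩∘⟨ (refl⟩∘⟨ ⊗-∘) ⟨
    F₁ C.λ⇒ ∘ (μ⇒ ∘ ((ε⇒ ∘ id) ⊗₁ (id ∘ to R)))   ≈⟨ refl⟩∘⟨ (refl⟩∘⟨ ⊗-resp-≈ identityʳ identityˡ) ⟩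
    F₁ C.λ⇒ ∘ (μ⇒ ∘ (ε⇒ ⊗₁ to R))                 ∎)

  represents-σ : ∀ {A B} {R : Rep A} {S : Rep B} → Represents (R ⊗ᴿ S) (S ⊗ᴿ R) σ C.σ
  represents-σ {R = R} {S} = represents (begin
    (μ⇒ ∘ (to S ⊗₁ to R)) ∘ σ      ≈⟨ assoc ⟩
    μ⇒ ∘ ((to S ⊗₁ to R) ∘ σ)      ≈⟨ refl⟩∘⟨ σ-nat ⟨
    μ⇒ ∘ (σ ∘ (to R ⊗₁ to S))      ≈⟨ sym-assoc ⟩
    (μ⇒ ∘ σ) ∘ (to R ⊗₁ to S)      ≈⟨ ≈.sym F-σ ⟩∘⟨refl ⟩
    (F₁ C.σ ∘ μ⇒) ∘ (to R ⊗₁ to S) ≈⟨ assoc ⟩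
    F₁ C.σ ∘ (μ⇒ ∘ (to R ⊗₁ to S)) ∎)

  represents-interchange : ∀ {A B} {R : Rep A} {S : Rep B} →
    Represents ((R ⊗ᴿ R) ⊗ᴿ (S ⊗ᴿ S)) ((R ⊗ᴿ S) ⊗ᴿ (R ⊗ᴿ S)) interchange C.interchange
  represents-interchange =
    represents-∘ represents-α⇐
      (represents-∘ (represents-⊗ represents-id
                       (represents-∘ represents-α⇒ (represents-∘ (represents-⊗ represents-σ represents-id) represents-α⇐)))
                    represents-α⇒)

  represents-del : ∀ {A} {A' : Obj} (p : F₀ A ≡ A') → Represents (base p) unitᴿ del C.del
  represents-del refl = represents (≈.trans (≈.sym F-del) (≈.sym identityʳ))

  represents-copy : ∀ {A} {A' : Obj} (p : F₀ A ≡ A') → Represents (base p) (base p ⊗ᴿ base p) copy C.copy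
  represents-copy refl = represents (begin
    (μ⇒ ∘ (id ⊗₁ id)) ∘ copy ≈⟨ (refl⟩∘⟨ ⊗-id) ⟩∘⟨refl ⟩
    (μ⇒ ∘ id) ∘ copy         ≈⟨ identityʳ ⟩∘⟨refl ⟩
    μ⇒ ∘ copy                ≈⟨ F-copy ⟨
    F₁ C.copy                ≈⟨ identityʳ ⟨
    F₁ C.copy ∘ id           ∎)

  represents-copy-⊗ : ∀ {A B} {R : Rep A} {S : Rep B} →
                      Represents R (R ⊗ᴿ R) copy C.copy → Represents S (S ⊗ᴿ S) copy C.copy →
                      Represents (R ⊗ᴿ S) ((R ⊗ᴿ S) ⊗ᴿ (R ⊗ᴿ S)) copy C.copy
  represents-copy-⊗ copyᴿ copyˢ =
    represents-resp-≈ (≈.sym copy-⊗) (C≈.sym C.copy-⊗)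
                      (represents-∘ represents-interchange (represents-⊗ copyᴿ copyˢ))

  represents-cascade : ∀ {P P' X Y Z} {R : Rep P} {R' : Rep P'} {U : Rep X} {V : Rep Y} {W : Rep Z}
                         {q' x' r' q x r} →
                       Represents R (R ⊗ᴿ R) copy C.copy → Represents (R ⊗ᴿ V) W q' q →
                       Represents (R' ⊗ᴿ U) V x' x → Represents R R' r' r →
                       Represents (R ⊗ᴿ U) W (cascade 𝒟 q' x' r') (cascade 𝒞 q x r)
  represents-cascade copyᴿ q-rep x-rep r-rep =
    represents-∘ q-rep
      (represents-∘ (represents-⊗ represents-id (represents-∘ x-rep (represents-⊗ r-rep represents-id)))
                    (represents-∘ represents-α⇒ (represents-⊗ copyᴿ represents-id)))

  represents-Functional : ∀ {A B} {R : Rep A} {S : Rep B} {g f} →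
                          Represents R (R ⊗ᴿ R) copy C.copy → Represents S (S ⊗ᴿ S) copy C.copy →
                          Represents R S g f → C.Functional f → Functional g
  represents-Functional copyᴿ copyˢ g-rep =
    transport (represents-∘ copyˢ g-rep) (represents-∘ (represents-⊗ g-rep g-rep) copyᴿ)

module SimulatorTransport {o ℓ e r o' ℓ' e' r'} {𝒯 : TCCategory o ℓ e r}
                          {𝒯' : TCCategory o' ℓ' e' r'} (𝔽 : TCFunctor 𝒯 𝒯') where
  private
    module 𝒞 = TCCategory 𝒯
    module 𝒞≈ {A B} = IsEquivalence (𝒞.≈-equiv {A} {B})
  open TCCategory 𝒯'
  open HomReasoning cat
  open TCFunctor 𝔽
  open Transport gsFunctor
  open Simulator

  ℙ : ∀ A → Rep A
  ℙ A = base refl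

  𝕋 : Rep 𝒞.T
  𝕋 = base F-T

  ℂ : Rep 𝒞.C
  ℂ = base F-C

  𝕋ℂ : Rep (𝒞.T 𝒞.⊗₀ 𝒞.C)
  𝕋ℂ = 𝕋 ⊗ᴿ ℂ

  -- Fsim and Fq are, definitionally, F₁ᴿ for these representations.
  Fsim-represents : ∀ {P} (s : P 𝒞.⊗₀ 𝒞.C 𝒞.⇒ 𝒞.T 𝒞.⊗₀ 𝒞.C) → Represents (ℙ P ⊗ᴿ ℂ) 𝕋ℂ (Fsim s) s
  Fsim-represents {P} = represents-F₁ᴿ (ℙ P ⊗ᴿ ℂ) 𝕋ℂ

  Fq-represents : ∀ {P} (q : P 𝒞.⊗₀ (𝒞.T 𝒞.⊗₀ 𝒞.C) 𝒞.⇒ 𝒞.T 𝒞.⊗₀ 𝒞.C) →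
                  Represents (ℙ P ⊗ᴿ 𝕋ℂ) 𝕋ℂ (Fq q) q
  Fq-represents {P} = represents-F₁ᴿ (ℙ P ⊗ᴿ 𝕋ℂ) 𝕋ℂ

  represents-IsSimulator : ∀ {P} {R : Rep P} {s g} →
                           Represents R (R ⊗ᴿ R) copy 𝒞.copy → Represents (R ⊗ᴿ ℂ) 𝕋ℂ g s →
                           IsSimulator 𝒯 P s → IsSimulator 𝒯' ⟦ R ⟧ g
  represents-IsSimulator {R = R} copyᴿ g-rep isSim = record
    { sT            = F₁ᴿ R 𝕋 sT
    ; sC            = F₁ᴿ (R ⊗ᴿ ℂ) ℂ sC
    ; sT-functional = represents-Functional copyᴿ (represents-copy F-T) sTᴿ sT-functional
    ; decompose     = transport g-rep
                        (represents-∘ (represents-⊗ sTᴿ sCᴿ)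
                                      (represents-∘ represents-α⇒ (represents-⊗ copyᴿ represents-id)))
                        decompose
    ; marginalT     = transport (represents-∘ (represents-⊗ represents-id (represents-del F-C)) g-rep)
                                (represents-⊗ sTᴿ (represents-del F-C)) marginalT
    ; marginalC     = transport (represents-∘ represents-λ⇒
                                   (represents-∘ (represents-⊗ (represents-del F-T) represents-id) g-rep))
                                sCᴿ marginalC
    }
    where
      open IsSimulator isSim
      sTᴿ : Represents R 𝕋 (F₁ᴿ R 𝕋 sT) sT
      sTᴿ = represents-F₁ᴿ R 𝕋 sT
      sCᴿ : Represents (R ⊗ᴿ ℂ) ℂ (F₁ᴿ (R ⊗ᴿ ℂ) ℂ sC) sC
      sCᴿ = represents-F₁ᴿ (R ⊗ᴿ ℂ) ℂ sC

  Fsim-IsSimulator : ∀ {P} {s : P 𝒞.⊗₀ 𝒞.C 𝒞.⇒ 𝒞.T 𝒞.⊗₀ 𝒞.C} →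
                     IsSimulator 𝒯 P s → IsSimulator 𝒯' (F₀ P) (Fsim s)
  Fsim-IsSimulator {s = s} = represents-IsSimulator (represents-copy refl) (Fsim-represents s)

  Fsimulator : Simulator 𝒯 → Simulator 𝒯'
  Fsimulator s = simulator (F₀ (P s)) (Fsim (run s)) (Fsim-IsSimulator (isSim s))

  Fq-resp-≈ : ∀ {P} {q q' : P 𝒞.⊗₀ (𝒞.T 𝒞.⊗₀ 𝒞.C) 𝒞.⇒ 𝒞.T 𝒞.⊗₀ 𝒞.C} → q 𝒞.≈ q' → Fq q ≈ Fq q'
  Fq-resp-≈ q≈q' = refl⟩∘⟨ (F-resp-≈ q≈q' ⟩∘⟨refl)

  Fq-≽ : ∀ {P} {q q' : P 𝒞.⊗₀ (𝒞.T 𝒞.⊗₀ 𝒞.C) 𝒞.⇒ 𝒞.T 𝒞.⊗₀ 𝒞.C} → q 𝒞.≽ q' → Fq q ≽ Fq q'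
  Fq-≽ q≽q' = ≽-trans (≈⇒≽ 𝒯' sym-assoc) (≽-trans (≽-∘ _ (F-≽ q≽q')) (≈⇒≽ 𝒯' assoc))

  Fq-idQ : ∀ P → Fq (idQ 𝒯 P) ≈ idQ 𝒯' (F₀ P)
  Fq-idQ P = transport (Fq-represents (idQ 𝒯 P))
                       (represents-∘ represents-λ⇒ (represents-⊗ (represents-del refl) represents-id)) 𝒞≈.refl

  Fq-compQ : ∀ {P₁ P₂} (r₂ : P₂ 𝒞.⇒ P₁) q₁ q₂ →
             Fq (compQ 𝒯 r₂ q₁ q₂) ≈ compQ 𝒯' (F₁ r₂) (Fq q₁) (Fq q₂)
  Fq-compQ r₂ q₁ q₂ =
    transport (Fq-represents (compQ 𝒯 r₂ q₁ q₂))
              (represents-cascade (represents-copy refl) (Fq-represents q₂) (Fq-represents q₁) (represents-F₁ r₂))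
              𝒞≈.refl

  F-IsSimMor : ∀ {s s' r q} → IsSimMor 𝒯 s s' r q →
               IsSimMor 𝒯' (Fsimulator s) (Fsimulator s') (F₁ r) (Fq q)
  F-IsSimMor {s} {s'} {r} {q} isMor = record
    { r-functional = represents-Functional (represents-copy refl) (represents-copy refl)
                                           (represents-F₁ r) r-functional
    ; q-simulator  = represents-IsSimulator (represents-copy-⊗ (represents-copy refl) (represents-copy F-T))
                                            (represents-∘ (Fq-represents q) represents-α⇒) q-simulator
    ; q-bounded    = ≽-trans (≈⇒≽ 𝒯' (≈.sym (Fq-idQ (P s')))) (Fq-≽ q-bounded)
    ; factor       = transport (Fsim-represents (run s'))
                       (represents-cascade (represents-copy refl) (Fq-represents q)
                                           (Fsim-represents (run s)) (represents-F₁ r))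
                       factor
    }
    where open IsSimMor isMor

mainTheorem9 : ∀ {o ℓ e r o' ℓ' e' r'} {𝒯 : TCCategory o ℓ e r} {𝒯' : TCCategory o' ℓ' e' r'}
    (𝔽 : TCFunctor 𝒯 𝒯') → SimFunctor 𝔽
mainTheorem9 𝔽 = record
  { obj-isSim = λ s → Fsim-IsSimulator (isSim s)
  ; mor-isMor = λ m → F-IsSimMor (isMor m)
  ; resp-≈    = λ _ _ r≈r' q≈q' → F-resp-≈ r≈r' , Fq-resp-≈ q≈q'
  ; pres-id   = λ s → F-id , Fq-idQ (P s)
  ; pres-∘    = λ m₁ m₂ → F-∘ , Fq-compQ (rm m₂) (qm m₁) (qm m₂)
  }
  where
    open TCFunctor 𝔽
    open SimulatorTransport 𝔽
    open Simulator
    open SimMor
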